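{- Let $m\ge1$, $n\ge1$ be integers, $S_{m;n}(t)=\sum_{k=0}^{n-1}T^{(m)}_{n,k}t^k$, and write $\widehat F_{m;n}(t)=\dfrac{tS_{m;n}(t)}{(1-t)^{mn+1}}=\sum_{\ell\ge0}f_{m;n}(\ell)t^\ell$ (so $f_{m;n}(0)=0$). Then for every integer $k\ge0$, \[ T^{(m)}_{n,k}=\sum_{\ell=1}^{k+1}(-1)^{k-\ell+1}\binom{mn+1}{k-\ell+1}f_{m;n}(\ell). \] In particular, for $m=2$ and $n\ge1$, \[ T^{(2)}_{n,k}=\sum_{\ell=1}^{k+1}(-1)^{k-\ell+1}\binom{2n+1}{k-\ell+1}f_{2;n}(\ell)=\sum_{\ell=1}^{k+1}(-1)^{k-\ell+1}\binom{2n+1}{k-\ell+1}S(n+\ell,\ell), \] where $S(u,v)$ is the Stirling number of the second kind.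
   Context: Let $m\ge1$, $n\ge1$ be integers. An $m$-Stirling permutation of order $n$ is a word $a_1a_2\cdots a_{mn}$ that is a permutation of the multiset in which each of $1,2,\dots,n$ occurs exactly $m$ times, such that whenever $u<v<w$ and $a_u=a_w$, one has $a_u\ge a_v$. A descent of such a word is an index $j\in\{1,\dots,mn-1\}$ with $a_j>a_{j+1}$. The $m$th-order Eulerian number $T^{(m)}_{n,k}$ is the number of $m$-Stirling permutations of order $n$ with exactly $k$ descents; by convention $T^{(m)}_{n,k}=0$ for $k<0$ or $k\ge n$, and $T^{(m)}_{1,0}=1$. $S(u,v)$ is the number of partitions of a $u$-element set into $v$ nonempty blocks. -}

module Defs where

open import Data.Bool using (Bool; true; false; _∧_; if_then_else_)
open import Data.Nat using (ℕ; zero; suc; _+_; _*_; _∸_; _≡ᵇ_; _≤ᵇ_; _<ᵇ_)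
open import Data.Nat.Combinatorics using (_C_)
open import Data.List using (List; []; _∷_; map; concatMap; length; filterᵇ; upTo)
open import Data.Nat.ListAction using (sum)
open import Data.Bool.ListAction using (and)
open import Data.Integer as ℤ using (ℤ; +_)

words : ℕ → ℕ → List (List ℕ)
words zero    n = [] ∷ []
words (suc L) n = concatMap (λ w → map (λ a → suc a ∷ w) (upTo n)) (words L n)

count : ℕ → List ℕ → ℕ
count a []       = 0
count a (x ∷ xs) = (if a ≡ᵇ x then 1 else 0) + count a xs

isMultisetPerm : ℕ → ℕ → List ℕ → Bool
isMultisetPerm m n w =
  (length w ≡ᵇ m * n) ∧ and (map (λ i → count (suc i) w ≡ᵇ m) (upTo n))

-- the letter at (0-based) position u (default 0 outside the word)
nth : List ℕ → ℕ → ℕ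
nth []       _       = 0
nth (x ∷ xs) zero    = x
nth (x ∷ xs) (suc u) = nth xs u

stirlingCond : List ℕ → Bool
stirlingCond a =
  and (map (λ u → and (map (λ v → and (map (λ w →
        if (u <ᵇ v) ∧ (v <ᵇ w) ∧ (nth a u ≡ᵇ nth a w)
        then nth a v ≤ᵇ nth a u else true)
      (upTo L))) (upTo L))) (upTo L))
  where L = length a

des : List ℕ → ℕ
des []           = 0
des (x ∷ [])     = 0
des (x ∷ y ∷ xs) = (if y <ᵇ x then 1 else 0) + des (y ∷ xs)

stirlingPerms : ℕ → ℕ → List (List ℕ)
stirlingPerms m n = filterᵇ (λ w → isMultisetPerm m n w ∧ stirlingCond w) (words (m * n) n)

T : ℕ → ℕ → ℕ → ℕ
T m n k = length (filterᵇ (λ w → des w ≡ᵇ k) (stirlingPerms m n))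

-- f_{m;n}(ℓ) = [t^ℓ] t S_{m;n}(t) / (1-t)^{mn+1}, where
-- S_{m;n}(t) = Σ_{k=0}^{n-1} T^{(m)}_{n,k} t^k and
-- 1/(1-t)^{N+1} = Σ_{r≥0} C(r+N, N) t^r  (Cauchy product of the two series)
f : ℕ → ℕ → ℕ → ℕ
f m n zero    = 0
f m n (suc j) = sum (map (λ i → T m n i * ((j ∸ i + m * n) C (m * n))) (upTo (suc j)))

S₂ : ℕ → ℕ → ℕ
S₂ zero    zero    = 1
S₂ zero    (suc v) = 0
S₂ (suc u) zero    = 0
S₂ (suc u) (suc v) = suc v * S₂ u (suc v) + S₂ u v

altSum : ℕ → (ℕ → ℕ) → ℕ → ℤ
altSum N g k =
  Data.List.foldr ℤ._+_ (+ 0)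
    (map (λ i → let ℓ = suc i in
                ((ℤ.- (+ 1)) ℤ.^ (k + 1 ∸ ℓ)) ℤ.* (+ ((N C (k + 1 ∸ ℓ)) * g ℓ)))
         (upTo (suc k)))

{-# OPTIONS --safe #-}
module Submission where

-- Write τ k = T^(m)_{n,k} and N = mn. By definition f_{m;n}(j+1) is the j-th coefficient of the
-- power series τ(t) (1 - t)^-(N+1), and the alternating sum is the k-th coefficient of (1 - t)^(N+1)
-- times that series; so the first identity is (1 - t)^(N+1) (1 - t)^-(N+1) = 1, which is proved one
-- factor 1 - t at a time by summation by parts.
--
-- Every m-Stirling permutation of order n+1 (m ≥ 1) arises exactly once by raising all letters of one
-- of order n by 1 and inserting the block 1…1 into one of its mn+1 gaps. Inserting at the front or into
-- one of the d descents keeps d descents, the other mn-d gaps add one, whence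
-- T_{n+1,k} = (k+1) T_{n,k} + (mn-k+1) T_{n,k-1}. For m = 2 this says that F_n(j) = f_{2;n}(j+1)
-- satisfies F_{n+1}(j) - F_{n+1}(j-1) = (j+1) F_n(j), the recurrence of S(n+j+1, j+1).

open import Defs
open import Data.Nat using (ℕ; _*_; _+_; _≥_)
open import Data.Integer using (+_)
open import Data.Product using (_×_)
open import Relation.Binary.PropositionalEquality using (_≡_)

open import Data.Bool using (Bool; true; false; _∧_; if_then_else_) renaming (T to IsTrue)
import Data.Bool.ListAction
open import Data.Bool.Properties using (T-∧)
open import Data.Empty using (⊥-elim)
open import Data.Integer using (ℤ; 0ℤ; 1ℤ; -1ℤ)
import Data.Integer as ℤ
import Data.Integer.Properties as ℤ
open import Data.Integer.Solver using (module +-*-Solver)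
open import Data.List using (List; []; _∷_; map; concatMap; foldr; length; filterᵇ; upTo; applyUpTo; _++_; replicate)
open import Data.List.Membership.Propositional using (_∈_; _∉_; find; lose)
import Data.List.Membership.Propositional.Properties as ∈
open import Data.List.Membership.Propositional.Properties.WithK using (unique∧set⇒bag)
import Data.List.Properties as List
open import Data.List.Relation.Binary.BagAndSetEquality using (∼bag⇒↭)
open import Data.List.Relation.Binary.Permutation.Propositional
  using (_↭_; prep; ↭-refl; ↭-reflexive; ↭-sym; ↭-trans; module PermutationReasoning)
import Data.List.Relation.Binary.Permutation.Propositional.Properties as ↭
open import Data.List.Relation.Unary.All as All using (All; []; _∷_)
import Data.List.Relation.Unary.All.Properties as All
open import Data.List.Relation.Unary.AllPairs using ([]; _∷_)
open import Data.List.Relation.Unary.Any using (here; there)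
open import Data.List.Relation.Unary.Unique.Propositional using (Unique)
import Data.List.Relation.Unary.Unique.Propositional.Properties as Unique
open import Data.Nat using (zero; suc; _∸_; _≤_; _<_; z≤n; s≤s; _≡ᵇ_; _<ᵇ_; _≤?_)
open import Data.Nat.Combinatorics using (_C_; nCn≡1; nC1≡n; nCk+nC[k+1]≡[n+1]C[k+1])
open import Data.Nat.ListAction using (sum)
open import Data.Nat.ListAction.Properties using (sum-↭)
import Data.Nat.Properties as ℕ
open import Algebra.Properties.CommutativeSemigroup ℕ.+-commutativeSemigroup using (interchange)
open import Data.Product using (_,_; proj₁; proj₂; ∃-syntax)
open import Data.Sum using (inj₁; inj₂)
open import Data.Unit using (⊤; tt)
open import Function using (_∘_; mk⇔; Equivalence)
open import Relation.Binary.PropositionalEquality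
  using (_≗_; refl; sym; trans; cong; cong₂; subst; _→-setoid_; module ≡-Reasoning)
import Relation.Binary.Reasoning.Setoid as SetoidReasoning
open import Relation.Nullary using (yes; no)
open import Relation.Nullary.Decidable using (T?)
open import Relation.Nullary.Negation using (¬_)
open import Relation.Unary using (Decidable)

open +-*-Solver

-- Finite sums and convolution of integer sequences

∑< : ℕ → (ℕ → ℤ) → ℤ
∑< zero    h = 0ℤ
∑< (suc n) h = ∑< n h ℤ.+ h n

infixl 10 ∑<
syntax ∑< n (λ i → e) = ∑[ i < n ] e

∑<-cong : ∀ n {h g : ℕ → ℤ} → (∀ {i} → i < n → h i ≡ g i) → ∑< n h ≡ ∑< n g
∑<-cong zero    eq = refl
∑<-cong (suc n) eq = cong₂ ℤ._+_ (∑<-cong n (eq ∘ ℕ.m<n⇒m<1+n)) (eq ℕ.≤-refl)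

∑<-suc : ∀ n (h : ℕ → ℤ) → ∑< (suc n) h ≡ h 0 ℤ.+ ∑< n (h ∘ suc)
∑<-suc zero    h = ℤ.+-comm 0ℤ (h 0)
∑<-suc (suc n) h = trans (cong (ℤ._+ h (suc n)) (∑<-suc n h)) (ℤ.+-assoc (h 0) _ _)

∑<-zero : ∀ n → ∑< n (λ _ → 0ℤ) ≡ 0ℤ
∑<-zero zero    = refl
∑<-zero (suc n) = trans (ℤ.+-identityʳ (∑< n (λ _ → 0ℤ))) (∑<-zero n)

∑<-+ : ∀ n (h g : ℕ → ℤ) → ∑[ i < n ] (h i ℤ.+ g i) ≡ ∑< n h ℤ.+ ∑< n g
∑<-+ zero    h g = refl
∑<-+ (suc n) h g = trans (cong (ℤ._+ (h n ℤ.+ g n)) (∑<-+ n h g))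
  (solve 4 (λ a b c d → (a :+ b) :+ (c :+ d) := (a :+ c) :+ (b :+ d)) refl (∑< n h) (∑< n g) (h n) (g n))

∑<-- : ∀ n (h g : ℕ → ℤ) → ∑[ i < n ] (h i ℤ.- g i) ≡ ∑< n h ℤ.- ∑< n g
∑<-- zero    h g = refl
∑<-- (suc n) h g = trans (cong (ℤ._+ (h n ℤ.- g n)) (∑<-- n h g))
  (solve 4 (λ a b c d → (a :- b) :+ (c :- d) := (a :+ c) :- (b :+ d)) refl (∑< n h) (∑< n g) (h n) (g n))

∑<-*ˡ : ∀ n c (h : ℕ → ℤ) → ∑[ i < n ] (c ℤ.* h i) ≡ c ℤ.* ∑< n h
∑<-*ˡ zero    c h = sym (ℤ.*-zeroʳ c)
∑<-*ˡ (suc n) c h =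
  trans (cong (ℤ._+ (c ℤ.* h n)) (∑<-*ˡ n c h)) (sym (ℤ.*-distribˡ-+ c (∑< n h) (h n)))

∑<-reverse : ∀ n (h : ℕ → ℤ) → ∑< (suc n) h ≡ ∑[ i < suc n ] h (n ∸ i)
∑<-reverse zero    h = refl
∑<-reverse (suc n) h = begin
  ∑< (suc n) h ℤ.+ h (suc n)                ≡⟨ cong (ℤ._+ h (suc n)) (∑<-reverse n h) ⟩
  ∑[ i < suc n ] h (n ∸ i) ℤ.+ h (suc n)    ≡⟨ ℤ.+-comm _ (h (suc n)) ⟩
  h (suc n) ℤ.+ ∑[ i < suc n ] h (n ∸ i)    ≡⟨ ∑<-suc (suc n) (λ i → h (suc n ∸ i)) ⟨
  ∑[ i < suc (suc n) ] h (suc n ∸ i)        ∎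
  where open ≡-Reasoning

foldr-applyUpTo : ∀ n (h : ℕ → ℤ) g → foldr ℤ._+_ 0ℤ (map h (applyUpTo g n)) ≡ ∑< n (h ∘ g)
foldr-applyUpTo zero    h g = refl
foldr-applyUpTo (suc n) h g =
  trans (cong (λ s → h (g 0) ℤ.+ s) (foldr-applyUpTo n h (g ∘ suc))) (sym (∑<-suc n (h ∘ g)))

sum-applyUpTo : ∀ n (h : ℕ → ℕ) g → + sum (map h (applyUpTo g n)) ≡ ∑[ i < n ] (+ h (g i))
sum-applyUpTo zero    h g = refl
sum-applyUpTo (suc n) h g = trans (ℤ.pos-+ (h (g 0)) _)
  (trans (cong (λ s → + h (g 0) ℤ.+ s) (sum-applyUpTo n h (g ∘ suc))) (sym (∑<-suc n (λ i → + h (g i)))))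

-- Integer sequences are read as power series: ⋆ is their product, δ is 1, Δ multiplies by 1 - t and
-- shift multiplies by t.

infixl 7 _⋆_

_⋆_ : (ℕ → ℤ) → (ℕ → ℤ) → ℕ → ℤ
(a ⋆ c) k = ∑[ i < suc k ] (a i ℤ.* c (k ∸ i))

δ : ℕ → ℤ
δ zero    = 1ℤ
δ (suc _) = 0ℤ

Δ : (ℕ → ℤ) → ℕ → ℤ
Δ c zero    = c zero
Δ c (suc r) = c (suc r) ℤ.- c r

shift : (ℕ → ℤ) → ℕ → ℤ
shift c zero    = 0ℤ
shift c (suc r) = c r

⋆-cong : ∀ {a a′ c c′ : ℕ → ℤ} → a ≗ a′ → c ≗ c′ → a ⋆ c ≗ a′ ⋆ c′
⋆-cong a≗a′ c≗c′ k = ∑<-cong (suc k) (λ {i} _ → cong₂ ℤ._*_ (a≗a′ i) (c≗c′ (k ∸ i)))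

⋆-congˡ : ∀ {a a′} c → a ≗ a′ → a ⋆ c ≗ a′ ⋆ c
⋆-congˡ c a≗a′ = ⋆-cong {c = c} {c′ = c} a≗a′ (λ _ → refl)

⋆-congʳ : ∀ a {c c′} → c ≗ c′ → a ⋆ c ≗ a ⋆ c′
⋆-congʳ a = ⋆-cong {a = a} {a′ = a} (λ _ → refl)

⋆-comm : ∀ a c → a ⋆ c ≗ c ⋆ a
⋆-comm a c k = begin
  ∑[ i < suc k ] (a i ℤ.* c (k ∸ i))                ≡⟨ ∑<-reverse k _ ⟩
  ∑[ i < suc k ] (a (k ∸ i) ℤ.* c (k ∸ (k ∸ i)))    ≡⟨ ∑<-cong (suc k) swap ⟩
  ∑[ i < suc k ] (c i ℤ.* a (k ∸ i))                ∎
  where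
  open ≡-Reasoning
  swap : ∀ {i} → i < suc k → a (k ∸ i) ℤ.* c (k ∸ (k ∸ i)) ≡ c i ℤ.* a (k ∸ i)
  swap {i} (s≤s i≤k) rewrite ℕ.m∸[m∸n]≡n i≤k = ℤ.*-comm (a (k ∸ i)) (c i)

⋆-suc : ∀ a c k → (a ⋆ c) (suc k) ≡ (a ⋆ (c ∘ suc)) k ℤ.+ a (suc k) ℤ.* c 0
⋆-suc a c k = cong₂ ℤ._+_
  (∑<-cong (suc k) (λ {i} i<1+k → cong (λ r → a i ℤ.* c r) (ℕ.+-∸-assoc 1 (ℕ.≤-pred i<1+k))))
  (cong (λ r → a (suc k) ℤ.* c r) (ℕ.n∸n≡0 k))

⋆-identityʳ : ∀ a → a ⋆ δ ≗ a
⋆-identityʳ a zero    = trans (ℤ.+-identityˡ _) (ℤ.*-identityʳ (a 0))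
⋆-identityʳ a (suc k) = begin
  (a ⋆ δ) (suc k)
    ≡⟨ ⋆-suc a δ k ⟩
  (a ⋆ (λ _ → 0ℤ)) k ℤ.+ a (suc k) ℤ.* 1ℤ
    ≡⟨ cong₂ ℤ._+_ zero-kernel (ℤ.*-identityʳ (a (suc k))) ⟩
  0ℤ ℤ.+ a (suc k)
    ≡⟨ ℤ.+-identityˡ (a (suc k)) ⟩
  a (suc k) ∎
  where
  open ≡-Reasoning
  zero-kernel : (a ⋆ (λ _ → 0ℤ)) k ≡ 0ℤ
  zero-kernel = trans (∑<-cong (suc k) (λ {i} _ → ℤ.*-zeroʳ (a i))) (∑<-zero (suc k))

⋆-identityˡ : ∀ a → δ ⋆ a ≗ a
⋆-identityˡ a k = trans (⋆-comm δ a k) (⋆-identityʳ a k)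

⋆-distribʳ-+ : ∀ a b c → (λ i → a i ℤ.+ b i) ⋆ c ≗ (λ k → (a ⋆ c) k ℤ.+ (b ⋆ c) k)
⋆-distribʳ-+ a b c k =
  trans (∑<-cong (suc k) (λ {i} _ → ℤ.*-distribʳ-+ (c (k ∸ i)) (a i) (b i))) (∑<-+ (suc k) _ _)

shift-⋆ : ∀ a c k → (shift a ⋆ c) (suc k) ≡ (a ⋆ c) k
shift-⋆ a c k = trans (∑<-suc (suc k) _)
  (trans (cong (ℤ._+ (a ⋆ c) k) (ℤ.*-zeroˡ (c (suc k)))) (ℤ.+-identityˡ _))

Δ-⋆ : ∀ a c → Δ (a ⋆ c) ≗ a ⋆ Δ c
Δ-⋆ a c zero    = refl
Δ-⋆ a c (suc k) = begin
  (a ⋆ c) (suc k) ℤ.- (a ⋆ c) k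
    ≡⟨ cong (ℤ._- (a ⋆ c) k) (⋆-suc a c k) ⟩
  ((a ⋆ (c ∘ suc)) k ℤ.+ a (suc k) ℤ.* c 0) ℤ.- (a ⋆ c) k
    ≡⟨ solve 3 (λ x y z → (x :+ y) :- z := (x :- z) :+ y) refl ((a ⋆ (c ∘ suc)) k) (a (suc k) ℤ.* c 0) _ ⟩
  ((a ⋆ (c ∘ suc)) k ℤ.- (a ⋆ c) k) ℤ.+ a (suc k) ℤ.* c 0
    ≡⟨ cong (ℤ._+ a (suc k) ℤ.* c 0) (trans (∑<-cong (suc k) (λ {i} _ → distrib i)) (∑<-- (suc k) _ _)) ⟨
  (a ⋆ (Δ c ∘ suc)) k ℤ.+ a (suc k) ℤ.* Δ c 0
    ≡⟨ ⋆-suc a (Δ c) k ⟨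
  (a ⋆ Δ c) (suc k) ∎
  where
  open ≡-Reasoning
  distrib : ∀ i → a i ℤ.* Δ c (suc (k ∸ i)) ≡ a i ℤ.* c (suc (k ∸ i)) ℤ.- a i ℤ.* c (k ∸ i)
  distrib i = solve 3 (λ x y z → x :* (y :- z) := x :* y :- x :* z) refl (a i) (c (suc (k ∸ i))) (c (k ∸ i))

⋆-Δ : ∀ a c → a ⋆ Δ c ≗ Δ a ⋆ c
⋆-Δ a c k = begin
  (a ⋆ Δ c) k    ≡⟨ Δ-⋆ a c k ⟨
  Δ (a ⋆ c) k    ≡⟨ Δ-cong (⋆-comm a c) k ⟩
  Δ (c ⋆ a) k    ≡⟨ Δ-⋆ c a k ⟩
  (c ⋆ Δ a) k    ≡⟨ ⋆-comm c (Δ a) k ⟩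
  (Δ a ⋆ c) k    ∎
  where
  open ≡-Reasoning
  Δ-cong : ∀ {a b} → a ≗ b → Δ a ≗ Δ b
  Δ-cong a≗b zero    = a≗b 0
  Δ-cong a≗b (suc r) = cong₂ ℤ._-_ (a≗b (suc r)) (a≗b r)

-- The series (1 - t)^M and (1 - t)^-(N+1)

[1-t]^ : ℕ → ℕ → ℤ
[1-t]^ M r = (-1ℤ ℤ.^ r) ℤ.* + (M C r)

[1-t]^-[1+] : ℕ → ℕ → ℤ
[1-t]^-[1+] N r = + ((r + N) C N)

+-C-Pascal : ∀ n k → + (n C k) ℤ.+ + (n C suc k) ≡ + (suc n C suc k)
+-C-Pascal n k = trans (sym (ℤ.pos-+ (n C k) (n C suc k))) (cong +_ (nCk+nC[k+1]≡[n+1]C[k+1] n k))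

Δ-[1-t]^ : ∀ M → Δ ([1-t]^ M) ≗ [1-t]^ (suc M)
Δ-[1-t]^ M zero    = refl
Δ-[1-t]^ M (suc r) = begin
  (-1ℤ ℤ.* p) ℤ.* + (M C suc r) ℤ.- p ℤ.* + (M C r)
    ≡⟨ solve 3 (λ p x y → (con -1ℤ :* p) :* x :- p :* y := (con -1ℤ :* p) :* (y :+ x))
             refl p (+ (M C suc r)) (+ (M C r)) ⟩
  (-1ℤ ℤ.* p) ℤ.* (+ (M C r) ℤ.+ + (M C suc r))
    ≡⟨ cong ((-1ℤ ℤ.* p) ℤ.*_) (+-C-Pascal M r) ⟩
  (-1ℤ ℤ.* p) ℤ.* + (suc M C suc r) ∎
  where
  open ≡-Reasoning
  p = -1ℤ ℤ.^ r

Δ-[1-t]^-[1+] : ∀ N → Δ ([1-t]^-[1+] (suc N)) ≗ [1-t]^-[1+] N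
Δ-[1-t]^-[1+] N zero    = cong +_ (trans (nCn≡1 (suc N)) (sym (nCn≡1 N)))
Δ-[1-t]^-[1+] N (suc r) = begin
  + (suc n C suc N) ℤ.- + (n C suc N)
    ≡⟨ cong (ℤ._- + (n C suc N)) (+-C-Pascal n N) ⟨
  (+ (n C N) ℤ.+ + (n C suc N)) ℤ.- + (n C suc N)
    ≡⟨ solve 2 (λ x y → (x :+ y) :- y := x) refl (+ (n C N)) (+ (n C suc N)) ⟩
  + (n C N)
    ≡⟨ cong (λ n → + (n C N)) (ℕ.+-suc r N) ⟩
  + ((suc r + N) C N) ∎
  where
  open ≡-Reasoning
  n = r + suc N

Δ-[1-t]^-[1+]-zero : Δ ([1-t]^-[1+] 0) ≗ δ
Δ-[1-t]^-[1+]-zero zero    = refl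
Δ-[1-t]^-[1+]-zero (suc r) = refl

[1-t]^-zero : [1-t]^ 0 ≗ δ
[1-t]^-zero zero    = refl
[1-t]^-zero (suc r) = ℤ.*-zeroʳ (-1ℤ ℤ.^ suc r)

[1-t]^-inverse : ∀ N a → (a ⋆ [1-t]^-[1+] N) ⋆ [1-t]^ (suc N) ≗ a
[1-t]^-inverse N a = begin
  (a ⋆ [1-t]^-[1+] N) ⋆ [1-t]^ (suc N)    ≈⟨ ⋆-congʳ (a ⋆ [1-t]^-[1+] N) (sym ∘ Δ-[1-t]^ N) ⟩
  (a ⋆ [1-t]^-[1+] N) ⋆ Δ ([1-t]^ N)      ≈⟨ ⋆-Δ (a ⋆ [1-t]^-[1+] N) ([1-t]^ N) ⟩
  Δ (a ⋆ [1-t]^-[1+] N) ⋆ [1-t]^ N        ≈⟨ ⋆-congˡ ([1-t]^ N) (Δ-⋆ a ([1-t]^-[1+] N)) ⟩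
  (a ⋆ Δ ([1-t]^-[1+] N)) ⋆ [1-t]^ N      ≈⟨ peel N ⟩
  a                                       ∎
  where
  open SetoidReasoning (ℕ →-setoid ℤ)
  peel : ∀ N → (a ⋆ Δ ([1-t]^-[1+] N)) ⋆ [1-t]^ N ≗ a
  peel zero = begin
    (a ⋆ Δ ([1-t]^-[1+] 0)) ⋆ [1-t]^ 0    ≈⟨ ⋆-cong (⋆-congʳ a Δ-[1-t]^-[1+]-zero) [1-t]^-zero ⟩
    (a ⋆ δ) ⋆ δ                           ≈⟨ ⋆-identityʳ (a ⋆ δ) ⟩
    a ⋆ δ                                 ≈⟨ ⋆-identityʳ a ⟩
    a                                     ∎
  peel (suc N) = begin
    (a ⋆ Δ ([1-t]^-[1+] (suc N))) ⋆ [1-t]^ (suc N)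
      ≈⟨ ⋆-congˡ ([1-t]^ (suc N)) (⋆-congʳ a (Δ-[1-t]^-[1+] N)) ⟩
    (a ⋆ [1-t]^-[1+] N) ⋆ [1-t]^ (suc N)
      ≈⟨ [1-t]^-inverse N a ⟩
    a ∎

[k+1]*[n+1]C[k+1]≡[n+1]*nCk : ∀ n k → suc k * (suc n C suc k) ≡ suc n * (n C k)
[k+1]*[n+1]C[k+1]≡[n+1]*nCk zero    zero    = refl
[k+1]*[n+1]C[k+1]≡[n+1]*nCk zero    (suc k) = ℕ.*-zeroʳ (suc (suc k))
[k+1]*[n+1]C[k+1]≡[n+1]*nCk (suc n) zero    =
  trans (ℕ.*-identityˡ _) (trans (nC1≡n (suc (suc n))) (sym (ℕ.*-identityʳ (suc (suc n)))))
[k+1]*[n+1]C[k+1]≡[n+1]*nCk (suc n) (suc k) = begin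
  suc (suc k) * (suc (suc n) C suc (suc k))
    ≡⟨ cong (suc (suc k) *_) (nCk+nC[k+1]≡[n+1]C[k+1] (suc n) (suc k)) ⟨
  suc (suc k) * (c + suc n C suc (suc k))
    ≡⟨ ℕ.*-distribˡ-+ (suc (suc k)) c _ ⟩
  (c + suc k * c) + suc (suc k) * (suc n C suc (suc k))
    ≡⟨ cong₂ (λ x y → (c + x) + y) ([k+1]*[n+1]C[k+1]≡[n+1]*nCk n k)
                                   ([k+1]*[n+1]C[k+1]≡[n+1]*nCk n (suc k)) ⟩
  (c + suc n * (n C k)) + suc n * (n C suc k)
    ≡⟨ ℕ.+-assoc c _ _ ⟩
  c + (suc n * (n C k) + suc n * (n C suc k))
    ≡⟨ cong (λ x → c + x) (ℕ.*-distribˡ-+ (suc n) (n C k) _) ⟨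
  c + suc n * (n C k + n C suc k)
    ≡⟨ cong (λ x → c + suc n * x) (nCk+nC[k+1]≡[n+1]C[k+1] n k) ⟩
  c + suc n * c ∎
  where
  open ≡-Reasoning
  c = suc n C suc k

[1-t]^-[1+]-constant : ∀ N → [1-t]^-[1+] N 0 ≡ 1ℤ
[1-t]^-[1+]-constant N = cong +_ (nCn≡1 N)

[1-t]^-[1+]-Pascal : ∀ L a →
  [1-t]^-[1+] (suc L) (suc a) ≡ [1-t]^-[1+] L (suc a) ℤ.+ [1-t]^-[1+] (suc L) a
[1-t]^-[1+]-Pascal L a =
  trans (solve 2 (λ x y → x := (x :- y) :+ y) refl ([1-t]^-[1+] (suc L) (suc a)) ([1-t]^-[1+] (suc L) a))
        (cong (ℤ._+ [1-t]^-[1+] (suc L) a) (Δ-[1-t]^-[1+] L (suc a)))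

[1-t]^-[1+]-absorption : ∀ L a →
  + suc L ℤ.* [1-t]^-[1+] (suc L) (suc a) ≡ + suc (suc (a + L)) ℤ.* [1-t]^-[1+] L (suc a)
[1-t]^-[1+]-absorption L a = begin
  + suc L ℤ.* + (suc (a + suc L) C suc L)      ≡⟨ cong (λ n → + suc L ℤ.* + (suc n C suc L)) (ℕ.+-suc a L) ⟩
  + suc L ℤ.* + (suc (suc (a + L)) C suc L)    ≡⟨ ℤ.pos-* (suc L) (suc (suc (a + L)) C suc L) ⟨
  + (suc L * (suc (suc (a + L)) C suc L))      ≡⟨ cong +_ ([k+1]*[n+1]C[k+1]≡[n+1]*nCk (suc (a + L)) L) ⟩
  + (suc (suc (a + L)) * (suc (a + L) C L))    ≡⟨ ℤ.pos-* (suc (suc (a + L))) (suc (a + L) C L) ⟩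
  + suc (suc (a + L)) ℤ.* [1-t]^-[1+] L (suc a) ∎
  where open ≡-Reasoning

[1-t]^-[1+]-eulerian : ∀ L i a →
  + suc i ℤ.* [1-t]^-[1+] (suc L) (suc a) ℤ.+ (+ L ℤ.- + i) ℤ.* [1-t]^-[1+] (suc L) a
    ≡ + suc (suc (a + i)) ℤ.* [1-t]^-[1+] L (suc a)
[1-t]^-[1+]-eulerian L i a = begin
  + suc i ℤ.* x ℤ.+ (+ L ℤ.- + i) ℤ.* [1-t]^-[1+] (suc L) a
    ≡⟨ cong (λ z → + suc i ℤ.* x ℤ.+ (+ L ℤ.- + i) ℤ.* z) previous≡x-y ⟩
  + suc i ℤ.* x ℤ.+ (+ L ℤ.- + i) ℤ.* (x ℤ.- y)
    ≡⟨ solve 4 (λ I L x y → (con (+ 1) :+ I) :* x :+ (L :- I) :* (x :- y)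
                          := (con (+ 1) :+ L) :* x :- (L :- I) :* y) refl (+ i) (+ L) x y ⟩
  + suc L ℤ.* x ℤ.- (+ L ℤ.- + i) ℤ.* y
    ≡⟨ cong (ℤ._- (+ L ℤ.- + i) ℤ.* y) ([1-t]^-[1+]-absorption L a) ⟩
  + suc (suc (a + L)) ℤ.* y ℤ.- (+ L ℤ.- + i) ℤ.* y
    ≡⟨ solve 4 (λ a L I y → (con (+ 2) :+ (a :+ L)) :* y :- (L :- I) :* y := (con (+ 2) :+ (a :+ I)) :* y)
             refl (+ a) (+ L) (+ i) y ⟩
  + suc (suc (a + i)) ℤ.* y ∎
  where
  open ≡-Reasoning
  x = [1-t]^-[1+] (suc L) (suc a)
  y = [1-t]^-[1+] L (suc a)
  previous≡x-y : [1-t]^-[1+] (suc L) a ≡ x ℤ.- y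
  previous≡x-y = trans (solve 2 (λ y z → z := (y :+ z) :- y) refl y ([1-t]^-[1+] (suc L) a))
                       (cong (ℤ._- y) (sym ([1-t]^-[1+]-Pascal L a)))

-- With τ = T(n, -) and L = mn this is the right-hand side of T(n+1, i) = (i+1) T(n,i) + (L-i+1) T(n,i-1).

eulerianStep : ℕ → (ℕ → ℤ) → ℕ → ℤ
eulerianStep L τ i = + suc i ℤ.* τ i ℤ.+ shift (λ j → (+ L ℤ.- + j) ℤ.* τ j) i

eulerianStep-⋆-[1-t]^-[1+] : ∀ L τ →
  eulerianStep L τ ⋆ [1-t]^-[1+] (suc L) ≗ λ j → + suc j ℤ.* (τ ⋆ [1-t]^-[1+] L) j
eulerianStep-⋆-[1-t]^-[1+] L τ zero = begin
  0ℤ ℤ.+ (+ 1 ℤ.* τ 0 ℤ.+ 0ℤ) ℤ.* P 0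
    ≡⟨ cong (λ b → 0ℤ ℤ.+ (+ 1 ℤ.* τ 0 ℤ.+ 0ℤ) ℤ.* b)
            (trans ([1-t]^-[1+]-constant (suc L)) (sym ([1-t]^-[1+]-constant L))) ⟩
  0ℤ ℤ.+ (+ 1 ℤ.* τ 0 ℤ.+ 0ℤ) ℤ.* [1-t]^-[1+] L 0
    ≡⟨ solve 2 (λ t b → con 0ℤ :+ (con (+ 1) :* t :+ con 0ℤ) :* b := con (+ 1) :* (con 0ℤ :+ t :* b))
             refl (τ 0) ([1-t]^-[1+] L 0) ⟩
  + 1 ℤ.* (0ℤ ℤ.+ τ 0 ℤ.* [1-t]^-[1+] L 0) ∎
  where
  open ≡-Reasoning
  P = [1-t]^-[1+] (suc L)
eulerianStep-⋆-[1-t]^-[1+] L τ (suc k) = begin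
  (eulerianStep L τ ⋆ P) (suc k)
    ≡⟨ ⋆-distribʳ-+ X (shift Y) P (suc k) ⟩
  (X ⋆ P) (suc k) ℤ.+ (shift Y ⋆ P) (suc k)
    ≡⟨ cong₂ ℤ._+_ (⋆-suc X P k) (shift-⋆ Y P k) ⟩
  ((X ⋆ (P ∘ suc)) k ℤ.+ X (suc k) ℤ.* P 0) ℤ.+ (Y ⋆ P) k
    ≡⟨ solve 3 (λ x z y → (x :+ z) :+ y := (x :+ y) :+ z) refl
             ((X ⋆ (P ∘ suc)) k) (X (suc k) ℤ.* P 0) ((Y ⋆ P) k) ⟩
  ((X ⋆ (P ∘ suc)) k ℤ.+ (Y ⋆ P) k) ℤ.+ X (suc k) ℤ.* P 0
    ≡⟨ cong₂ ℤ._+_ (trans (sym (∑<-+ (suc k) _ _)) (∑<-cong (suc k) termwise)) last ⟩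
  ∑[ i < suc k ] (K ℤ.* (τ i ℤ.* Q (suc (k ∸ i)))) ℤ.+ K ℤ.* (τ (suc k) ℤ.* Q 0)
    ≡⟨ cong (ℤ._+ K ℤ.* (τ (suc k) ℤ.* Q 0)) (∑<-*ˡ (suc k) K _) ⟩
  K ℤ.* (τ ⋆ (Q ∘ suc)) k ℤ.+ K ℤ.* (τ (suc k) ℤ.* Q 0)
    ≡⟨ ℤ.*-distribˡ-+ K ((τ ⋆ (Q ∘ suc)) k) _ ⟨
  K ℤ.* ((τ ⋆ (Q ∘ suc)) k ℤ.+ τ (suc k) ℤ.* Q 0)
    ≡⟨ cong (K ℤ.*_) (⋆-suc τ Q k) ⟨
  K ℤ.* (τ ⋆ Q) (suc k) ∎
  where
  open ≡-Reasoning
  P = [1-t]^-[1+] (suc L)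
  Q = [1-t]^-[1+] L
  K = + suc (suc k)
  X Y : ℕ → ℤ
  X i = + suc i ℤ.* τ i
  Y i = (+ L ℤ.- + i) ℤ.* τ i
  termwise : ∀ {i} → i < suc k →
    X i ℤ.* P (suc (k ∸ i)) ℤ.+ Y i ℤ.* P (k ∸ i) ≡ K ℤ.* (τ i ℤ.* Q (suc (k ∸ i)))
  termwise {i} i<1+k = begin
    X i ℤ.* P (suc (k ∸ i)) ℤ.+ Y i ℤ.* P (k ∸ i)
      ≡⟨ solve 5 (λ s l t b c → (s :* t) :* b :+ (l :* t) :* c := t :* (s :* b :+ l :* c)) refl
               (+ suc i) (+ L ℤ.- + i) (τ i) (P (suc (k ∸ i))) (P (k ∸ i)) ⟩
    τ i ℤ.* (+ suc i ℤ.* P (suc (k ∸ i)) ℤ.+ (+ L ℤ.- + i) ℤ.* P (k ∸ i))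
      ≡⟨ cong (τ i ℤ.*_) ([1-t]^-[1+]-eulerian L i (k ∸ i)) ⟩
    τ i ℤ.* (+ suc (suc (k ∸ i + i)) ℤ.* Q (suc (k ∸ i)))
      ≡⟨ cong (λ n → τ i ℤ.* (+ suc (suc n) ℤ.* Q (suc (k ∸ i)))) (ℕ.m∸n+n≡m (ℕ.≤-pred i<1+k)) ⟩
    τ i ℤ.* (K ℤ.* Q (suc (k ∸ i)))
      ≡⟨ solve 3 (λ t s b → t :* (s :* b) := s :* (t :* b)) refl (τ i) K (Q (suc (k ∸ i))) ⟩
    K ℤ.* (τ i ℤ.* Q (suc (k ∸ i))) ∎
  last : X (suc k) ℤ.* P 0 ≡ K ℤ.* (τ (suc k) ℤ.* Q 0)
  last = trans (cong (X (suc k) ℤ.*_) (trans ([1-t]^-[1+]-constant (suc L)) (sym ([1-t]^-[1+]-constant L))))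
               (ℤ.*-assoc K (τ (suc k)) (Q 0))

-- Stirling numbers of the second kind

v>u⇒S₂uv≡0 : ∀ {u v} → u < v → S₂ u v ≡ 0
v>u⇒S₂uv≡0 {zero}  {suc v} _         = refl
v>u⇒S₂uv≡0 {suc u} {suc v} (s≤s u<v)
  rewrite v>u⇒S₂uv≡0 (ℕ.m<n⇒m<1+n u<v) | v>u⇒S₂uv≡0 u<v = trans (ℕ.+-identityʳ _) (ℕ.*-zeroʳ (suc v))

S₂nn≡1 : ∀ n → S₂ n n ≡ 1
S₂nn≡1 zero    = refl
S₂nn≡1 (suc n) rewrite v>u⇒S₂uv≡0 (ℕ.n<1+n n) | S₂nn≡1 n = cong (_+ 1) (ℕ.*-zeroʳ n)

S₂[1+n]1≡1 : ∀ n → S₂ (suc n) 1 ≡ 1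
S₂[1+n]1≡1 zero    = refl
S₂[1+n]1≡1 (suc n) rewrite S₂[1+n]1≡1 n = refl

module _ (τ : ℕ → ℕ → ℤ) (τ-zero : τ 0 ≗ δ)
         (τ-suc : ∀ n → τ (suc n) ≗ eulerianStep (2 * n) (τ n)) where

  Δ-⋆-[1-t]^-[1+]-suc : ∀ n →
    Δ (τ (suc n) ⋆ [1-t]^-[1+] (2 * suc n)) ≗ λ j → + suc j ℤ.* (τ n ⋆ [1-t]^-[1+] (2 * n)) j
  Δ-⋆-[1-t]^-[1+]-suc n = begin
    Δ (τ (suc n) ⋆ [1-t]^-[1+] (2 * suc n))
      ≈⟨ Δ-⋆ (τ (suc n)) ([1-t]^-[1+] (2 * suc n)) ⟩
    τ (suc n) ⋆ Δ ([1-t]^-[1+] (2 * suc n))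
      ≈⟨ ⋆-congʳ (τ (suc n)) Δ-[1-t]^-[1+][2n+2] ⟩
    τ (suc n) ⋆ [1-t]^-[1+] (suc (2 * n))
      ≈⟨ ⋆-congˡ ([1-t]^-[1+] (suc (2 * n))) (τ-suc n) ⟩
    eulerianStep (2 * n) (τ n) ⋆ [1-t]^-[1+] (suc (2 * n))
      ≈⟨ eulerianStep-⋆-[1-t]^-[1+] (2 * n) (τ n) ⟩
    (λ j → + suc j ℤ.* (τ n ⋆ [1-t]^-[1+] (2 * n)) j) ∎
    where
    open SetoidReasoning (ℕ →-setoid ℤ)
    Δ-[1-t]^-[1+][2n+2] : Δ ([1-t]^-[1+] (2 * suc n)) ≗ [1-t]^-[1+] (suc (2 * n))
    Δ-[1-t]^-[1+][2n+2] r = subst (λ N → Δ ([1-t]^-[1+] N) r ≡ [1-t]^-[1+] (suc (2 * n)) r)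
                                  (sym (ℕ.*-suc 2 n)) (Δ-[1-t]^-[1+] (suc (2 * n)) r)

  ⋆-[1-t]^-[1+]≡S₂ : ∀ n j → (τ n ⋆ [1-t]^-[1+] (2 * n)) j ≡ + S₂ (n + suc j) (suc j)
  ⋆-[1-t]^-[1+]≡S₂ zero j = begin
    (τ 0 ⋆ [1-t]^-[1+] 0) j    ≡⟨ ⋆-congˡ ([1-t]^-[1+] 0) τ-zero j ⟩
    (δ ⋆ [1-t]^-[1+] 0) j      ≡⟨ ⋆-identityˡ ([1-t]^-[1+] 0) j ⟩
    + 1                        ≡⟨ cong +_ (S₂nn≡1 (suc j)) ⟨
    + S₂ (suc j) (suc j)       ∎
    where open ≡-Reasoning
  ⋆-[1-t]^-[1+]≡S₂ (suc n) zero = begin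
    (τ (suc n) ⋆ [1-t]^-[1+] (2 * suc n)) 0    ≡⟨ Δ-⋆-[1-t]^-[1+]-suc n 0 ⟩
    + 1 ℤ.* (τ n ⋆ [1-t]^-[1+] (2 * n)) 0      ≡⟨ ℤ.*-identityˡ _ ⟩
    (τ n ⋆ [1-t]^-[1+] (2 * n)) 0              ≡⟨ ⋆-[1-t]^-[1+]≡S₂ n 0 ⟩
    + S₂ (n + 1) 1                             ≡⟨ cong (λ u → + S₂ u 1) (ℕ.+-comm n 1) ⟩
    + S₂ (suc n) 1                             ≡⟨ cong +_ (trans (S₂[1+n]1≡1 n) (sym (S₂[1+n]1≡1 (n + 1)))) ⟩
    + S₂ (suc n + 1) 1                         ∎
    where open ≡-Reasoning
  ⋆-[1-t]^-[1+]≡S₂ (suc n) (suc j) = begin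
    F (suc j)
      ≡⟨ solve 2 (λ a b → a := b :+ (a :- b)) refl (F (suc j)) (F j) ⟩
    F j ℤ.+ Δ F (suc j)
      ≡⟨ cong₂ ℤ._+_ (⋆-[1-t]^-[1+]≡S₂ (suc n) j)
                     (trans (Δ-⋆-[1-t]^-[1+]-suc n (suc j))
                            (cong (K ℤ.*_) (⋆-[1-t]^-[1+]≡S₂ n (suc j)))) ⟩
    + S₂ (suc (n + suc j)) (suc j) ℤ.+ K ℤ.* + S₂ u (suc (suc j))
      ≡⟨ cong (λ w → + S₂ w (suc j) ℤ.+ K ℤ.* + S₂ u (suc (suc j))) (ℕ.+-suc n (suc j)) ⟨
    + S₂ u (suc j) ℤ.+ K ℤ.* + S₂ u (suc (suc j))
      ≡⟨ cong (λ z → + S₂ u (suc j) ℤ.+ z) (ℤ.pos-* (suc (suc j)) (S₂ u (suc (suc j)))) ⟨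
    + S₂ u (suc j) ℤ.+ + (suc (suc j) * S₂ u (suc (suc j)))
      ≡⟨ ℤ.pos-+ (S₂ u (suc j)) _ ⟨
    + (S₂ u (suc j) + suc (suc j) * S₂ u (suc (suc j)))
      ≡⟨ cong +_ (ℕ.+-comm (S₂ u (suc j)) _) ⟩
    + S₂ (suc u) (suc (suc j)) ∎
    where
    open ≡-Reasoning
    F = τ (suc n) ⋆ [1-t]^-[1+] (2 * suc n)
    K = + suc (suc j)
    u = n + suc (suc j)

-- Stirling permutations

Letter : ℕ → ℕ → Set
Letter n a = 0 < a × a ≤ n

∈-words⁻ : ∀ L n {w} → w ∈ words L n → length w ≡ L × All (Letter n) w
∈-words⁻ zero    n (here refl) = refl , []
∈-words⁻ (suc L) n w∈
  with v , v∈ , w∈′ ← find (∈.∈-concatMap⁻ _ {words L n} w∈)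
  with a , a∈ , refl ← ∈.∈-map⁻ _ w∈′
  with len , letters ← ∈-words⁻ L n v∈
  = cong suc len , (s≤s z≤n , ∈.∈-upTo⁻ a∈) ∷ letters

∈-words⁺ : ∀ L n {w} → length w ≡ L → All (Letter n) w → w ∈ words L n
∈-words⁺ zero    n {[]}        refl []                            = here refl
∈-words⁺ (suc L) n {suc a ∷ w} refl ((s≤s z≤n , 1+a≤n) ∷ letters) =
  ∈.∈-concatMap⁺ _
    (lose (∈-words⁺ L n refl letters) (∈.∈-map⁺ (λ b → suc b ∷ w) (∈.∈-upTo⁺ 1+a≤n)))

Unique-concatMap⁺ : ∀ {A B : Set} (g : A → List B) {xs} → Unique xs → (∀ {x} → x ∈ xs → Unique (g x)) →
  (∀ {x y z} → x ∈ xs → y ∈ xs → z ∈ g x → z ∈ g y → x ≡ y) → Unique (concatMap g xs)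
Unique-concatMap⁺ g {[]}     _            _        _           = []
Unique-concatMap⁺ g {x ∷ xs} (x∉xs ∷ uxs) unique-g g-injective =
  Unique.++⁺ (unique-g (here refl))
             (Unique-concatMap⁺ g uxs (unique-g ∘ there) (λ p q → g-injective (there p) (there q)))
             disjoint
  where
  disjoint : ∀ {z} → ¬ (z ∈ g x × z ∈ concatMap g xs)
  disjoint (z∈gx , z∈rest) with y , y∈xs , z∈gy ← find (∈.∈-concatMap⁻ g {xs} z∈rest) =
    All.lookup x∉xs y∈xs (g-injective (here refl) (there y∈xs) z∈gx z∈gy)

words-unique : ∀ L n → Unique (words L n)
words-unique zero    n = [] ∷ []
words-unique (suc L) n = Unique-concatMap⁺ extend (words-unique L n)
  (λ _ → Unique.map⁺ (ℕ.suc-injective ∘ List.∷-injectiveˡ) (Unique.upTo⁺ n))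
  (λ {v} {v′} _ _ p q → same-tail v v′ (∈.∈-map⁻ _ p) (∈.∈-map⁻ _ q))
  where
  extend : List ℕ → List (List ℕ)
  extend v = map (λ a → suc a ∷ v) (upTo n)
  same-tail : ∀ v v′ {z} →
    ∃[ a ] (a ∈ upTo n × z ≡ suc a ∷ v) → ∃[ a ] (a ∈ upTo n × z ≡ suc a ∷ v′) → v ≡ v′
  same-tail v v′ (_ , _ , refl) (_ , _ , eq) = List.∷-injectiveʳ eq

all-upTo⁻ : ∀ (p : ℕ → Bool) n → IsTrue (Data.Bool.ListAction.and (map p (upTo n))) →
  ∀ {i} → i < n → IsTrue (p i)
all-upTo⁻ p n t = All.applyUpTo⁻ (λ i → i) n (All.all⁺ p (upTo n) t)

all-upTo⁺ : ∀ (p : ℕ → Bool) n → (∀ {i} → i < n → IsTrue (p i)) →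
  IsTrue (Data.Bool.ListAction.and (map p (upTo n)))
all-upTo⁺ p n h = All.all⁻ p (All.applyUpTo⁺₁ (λ i → i) n h)

StirlingIdx : List ℕ → Set
StirlingIdx a = ∀ {u v w} → u < v → v < w → w < length a → nth a u ≡ nth a w → nth a v ≤ nth a u

stirlingCond⁻ : ∀ a → IsTrue (stirlingCond a) → StirlingIdx a
stirlingCond⁻ a t {u} {v} {w} u<v v<w w<L nu≡nw = ℕ.≤ᵇ⇒≤ _ _ (at-uvw (Equivalence.from T-∧
    (ℕ.<⇒<ᵇ u<v , Equivalence.from T-∧ (ℕ.<⇒<ᵇ v<w , ℕ.≡⇒≡ᵇ _ _ nu≡nw))))
  where
  L = length a
  v<L = ℕ.<-trans v<w w<L
  if-true⁻ : ∀ {c b} → IsTrue (if c then b else true) → IsTrue c → IsTrue b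
  if-true⁻ {true} t _ = t
  at-uvw = if-true⁻ (all-upTo⁻ _ L (all-upTo⁻ _ L (all-upTo⁻ _ L t (ℕ.<-trans u<v v<L)) v<L) w<L)

stirlingCond⁺ : ∀ a → StirlingIdx a → IsTrue (stirlingCond a)
stirlingCond⁺ a h =
  all-upTo⁺ _ L λ {u} _ → all-upTo⁺ _ L λ {v} _ → all-upTo⁺ _ L λ {w} w<L → if-true⁺ λ c →
    let u<v , c′ = Equivalence.to T-∧ c
        v<w , eq = Equivalence.to (T-∧ {v <ᵇ w}) c′
    in ℕ.≤⇒≤ᵇ (h (ℕ.<ᵇ⇒< u v u<v) (ℕ.<ᵇ⇒< v w v<w) w<L (ℕ.≡ᵇ⇒≡ _ _ eq))
  where
  L = length a
  if-true⁺ : ∀ {c b} → (IsTrue c → IsTrue b) → IsTrue (if c then b else true)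
  if-true⁺ {true}  f = f tt
  if-true⁺ {false} f = tt

Dominates : ℕ → List ℕ → Set
Dominates x []       = ⊤
Dominates x (y ∷ ys) = (x ∈ ys → y ≤ x) × Dominates x ys

Stirling : List ℕ → Set
Stirling []       = ⊤
Stirling (x ∷ xs) = Dominates x xs × Stirling xs

∈⇒nth : ∀ {x : ℕ} xs → x ∈ xs → ∃[ w ] (w < length xs × nth xs w ≡ x)
∈⇒nth (y ∷ ys) (here refl) = 0 , s≤s z≤n , refl
∈⇒nth (y ∷ ys) (there x∈) with w , w< , eq ← ∈⇒nth ys x∈ = suc w , s≤s w< , eq

nth-∈ : ∀ xs {w} → w < length xs → nth xs w ∈ xs
nth-∈ (y ∷ ys) {zero}  _        = here refl
nth-∈ (y ∷ ys) {suc w} (s≤s w<) = there (nth-∈ ys w<)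

DominatesIdx : ℕ → List ℕ → Set
DominatesIdx x xs = ∀ {v w} → v < w → w < length xs → nth xs w ≡ x → nth xs v ≤ x

DominatesIdx⇒Dominates : ∀ x xs → DominatesIdx x xs → Dominates x xs
DominatesIdx⇒Dominates x []       h = tt
DominatesIdx⇒Dominates x (y ∷ ys) h =
  (λ x∈ys → let w , w< , eq = ∈⇒nth ys x∈ys in h (s≤s z≤n) (s≤s w<) eq) ,
  DominatesIdx⇒Dominates x ys (λ v<w w< eq → h (s≤s v<w) (s≤s w<) eq)

Dominates⇒DominatesIdx : ∀ x xs → Dominates x xs → DominatesIdx x xs
Dominates⇒DominatesIdx x (y ∷ ys) (y≤x , _) {zero}  {suc w} _         (s≤s w<) eq =
  y≤x (subst (_∈ ys) eq (nth-∈ ys w<))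
Dominates⇒DominatesIdx x (y ∷ ys) (_ , d)   {suc v} {suc w} (s≤s v<w) (s≤s w<) eq =
  Dominates⇒DominatesIdx x ys d v<w w< eq

StirlingIdx⇒Stirling : ∀ a → StirlingIdx a → Stirling a
StirlingIdx⇒Stirling []       h = tt
StirlingIdx⇒Stirling (x ∷ xs) h =
  DominatesIdx⇒Dominates x xs (λ v<w w< eq → h (s≤s z≤n) (s≤s v<w) (s≤s w<) (sym eq)) ,
  StirlingIdx⇒Stirling xs (λ u<v v<w w< eq → h (s≤s u<v) (s≤s v<w) (s≤s w<) eq)

Stirling⇒StirlingIdx : ∀ a → Stirling a → StirlingIdx a
Stirling⇒StirlingIdx (x ∷ xs) (d , _) {zero}  {suc v} {suc w} _         (s≤s v<w) (s≤s w<) eq =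
  Dominates⇒DominatesIdx x xs d v<w w< (sym eq)
Stirling⇒StirlingIdx (x ∷ xs) (_ , s) {suc u} {suc v} {suc w} (s≤s u<v) (s≤s v<w) (s≤s w<) eq =
  Stirling⇒StirlingIdx xs s u<v v<w w< eq

record IsStirlingPerm (m n : ℕ) (w : List ℕ) : Set where
  field
    length≡  : length w ≡ m * n
    letters  : All (Letter n) w
    counts   : ∀ {i} → i < n → count (suc i) w ≡ m
    stirling : Stirling w

stirlingPerm? : ∀ m n → Decidable (λ w → IsTrue (isMultisetPerm m n w ∧ stirlingCond w))
stirlingPerm? m n w = T? (isMultisetPerm m n w ∧ stirlingCond w)

∈-stirlingPerms⁻ : ∀ m n {w} → w ∈ stirlingPerms m n → IsStirlingPerm m n w
∈-stirlingPerms⁻ m n {w} w∈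
  with w∈words , conditions ← ∈.∈-filter⁻ (stirlingPerm? m n) {xs = words (m * n) n} w∈
  with multiset , stirling ← Equivalence.to T-∧ conditions
  with length≡ , counts ← Equivalence.to T-∧ multiset
  = record
  { length≡  = ℕ.≡ᵇ⇒≡ _ _ length≡
  ; letters  = proj₂ (∈-words⁻ (m * n) n w∈words)
  ; counts   = ℕ.≡ᵇ⇒≡ _ _ ∘ all-upTo⁻ _ n counts
  ; stirling = StirlingIdx⇒Stirling w (stirlingCond⁻ w stirling)
  }

∈-stirlingPerms⁺ : ∀ m n {w} → IsStirlingPerm m n w → w ∈ stirlingPerms m n
∈-stirlingPerms⁺ m n {w} p = ∈.∈-filter⁺ (stirlingPerm? m n) (∈-words⁺ (m * n) n length≡ letters)
  (Equivalence.from T-∧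
    (Equivalence.from T-∧ (ℕ.≡⇒≡ᵇ _ _ length≡ , all-upTo⁺ _ n (ℕ.≡⇒≡ᵇ _ _ ∘ counts)) ,
     stirlingCond⁺ w (Stirling⇒StirlingIdx w stirling)))
  where open IsStirlingPerm p

stirlingPerms-unique : ∀ m n → Unique (stirlingPerms m n)
stirlingPerms-unique m n = Unique.filter⁺ (stirlingPerm? m n) (words-unique (m * n) n)

count-++ : ∀ a xs ys → count a (xs ++ ys) ≡ count a xs + count a ys
count-++ a []       ys = refl
count-++ a (x ∷ xs) ys = trans (cong (_+_ (if a ≡ᵇ x then 1 else 0)) (count-++ a xs ys))
  (sym (ℕ.+-assoc (if a ≡ᵇ x then 1 else 0) (count a xs) (count a ys)))

count-replicate : ∀ a r x → count a (replicate r x) ≡ (if a ≡ᵇ x then r else 0)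
count-replicate a zero    x with a ≡ᵇ x
... | true  = refl
... | false = refl
count-replicate a (suc r) x with a ≡ᵇ x in eq
... | true  = cong suc (trans (count-replicate a r x) (cong (λ b → if b then r else 0) eq))
... | false = trans (count-replicate a r x) (cong (λ b → if b then r else 0) eq)

count-↭ : ∀ a {xs ys} → xs ↭ ys → count a xs ≡ count a ys
count-↭ a {xs} {ys} p = begin
  count a xs                ≡⟨ count≡sum xs ⟩
  sum (map indicator xs)    ≡⟨ sum-↭ (↭.map⁺ indicator p) ⟩
  sum (map indicator ys)    ≡⟨ count≡sum ys ⟨
  count a ys                ∎
  where
  open ≡-Reasoning
  indicator : ℕ → ℕ
  indicator x = if a ≡ᵇ x then 1 else 0
  count≡sum : ∀ xs → count a xs ≡ sum (map indicator xs)
  count≡sum []       = refl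
  count≡sum (x ∷ xs) = cong (_+_ (indicator x)) (count≡sum xs)

count-map-suc : ∀ a w → count (suc a) (map suc w) ≡ count a w
count-map-suc a []      = refl
count-map-suc a (x ∷ w) = cong (_+_ (if a ≡ᵇ x then 1 else 0)) (count-map-suc a w)

count-0-positive : ∀ w → All (0 <_) w → count 0 w ≡ 0
count-0-positive []          []        = refl
count-0-positive (suc _ ∷ w) (_ ∷ pos) = count-0-positive w pos

∈-map-suc⁻ : ∀ {x} ys → suc x ∈ map suc ys → x ∈ ys
∈-map-suc⁻ ys p with y , y∈ , refl ← ∈.∈-map⁻ suc p = y∈

Dominates-map-suc⁺ : ∀ x ys → Dominates x ys → Dominates (suc x) (map suc ys)
Dominates-map-suc⁺ x []       _       = tt
Dominates-map-suc⁺ x (y ∷ ys) (f , d) =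
  (λ x∈ → s≤s (f (∈-map-suc⁻ ys x∈))) , Dominates-map-suc⁺ x ys d

Dominates-map-suc⁻ : ∀ x ys → Dominates (suc x) (map suc ys) → Dominates x ys
Dominates-map-suc⁻ x []       _       = tt
Dominates-map-suc⁻ x (y ∷ ys) (f , d) =
  (λ x∈ → ℕ.≤-pred (f (∈.∈-map⁺ suc x∈))) , Dominates-map-suc⁻ x ys d

Stirling-map-suc⁺ : ∀ w → Stirling w → Stirling (map suc w)
Stirling-map-suc⁺ []      _       = tt
Stirling-map-suc⁺ (x ∷ w) (d , s) = Dominates-map-suc⁺ x w d , Stirling-map-suc⁺ w s

Stirling-map-suc⁻ : ∀ w → Stirling (map suc w) → Stirling w
Stirling-map-suc⁻ []      _       = tt
Stirling-map-suc⁻ (x ∷ w) (d , s) = Dominates-map-suc⁻ x w d , Stirling-map-suc⁻ w s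

-- Inserting a block of ones

NoOne : List ℕ → Set
NoOne = All (1 <_)

NoOne⇒map-suc : ∀ v → NoOne v → ∃[ w ] (v ≡ map suc w × All (0 <_) w)
NoOne⇒map-suc []          []             = [] , refl , []
NoOne⇒map-suc (suc x ∷ v) (s≤s 0<x ∷ nv) with w , refl , pos ← NoOne⇒map-suc v nv = x ∷ w , refl , 0<x ∷ pos

data Insertion (k : ℕ) : List ℕ → List ℕ → Set where
  here  : ∀ {v} → Insertion k (replicate k 1 ++ v) v
  there : ∀ {y w v} → Insertion k w v → Insertion k (y ∷ w) (y ∷ v)

insertions : ℕ → List ℕ → List (List ℕ)
insertions k []      = (replicate k 1 ++ []) ∷ []
insertions k (y ∷ v) = (replicate k 1 ++ y ∷ v) ∷ map (y ∷_) (insertions k v)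

∈-insertions⁻ : ∀ k v {w} → w ∈ insertions k v → Insertion k w v
∈-insertions⁻ k []      (here refl) = here
∈-insertions⁻ k (y ∷ v) (here refl) = here
∈-insertions⁻ k (y ∷ v) (there w∈)
  with w , w∈′ , refl ← ∈.∈-map⁻ (y ∷_) w∈ = there (∈-insertions⁻ k v w∈′)

∈-insertions⁺ : ∀ {k w v} → Insertion k w v → w ∈ insertions k v
∈-insertions⁺ {v = []}    here            = here refl
∈-insertions⁺ {v = _ ∷ _} here            = here refl
∈-insertions⁺             (there {y} ins) = there (∈.∈-map⁺ (y ∷_) (∈-insertions⁺ ins))

Insertion-injective : ∀ {k w w′ v v′} → NoOne v → NoOne v′ →
  Insertion (suc k) w v → Insertion (suc k) w′ v′ → w ≡ w′ → v ≡ v′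
Insertion-injective _         _          here        here         eq = List.++-cancelˡ (replicate _ 1) _ _ eq
Insertion-injective _         (1<y ∷ _)  here        (there _)    eq =
  ⊥-elim (ℕ.<-irrefl (List.∷-injectiveˡ eq) 1<y)
Insertion-injective (1<y ∷ _) _          (there _)   here         eq =
  ⊥-elim (ℕ.<-irrefl (sym (List.∷-injectiveˡ eq)) 1<y)
Insertion-injective (_ ∷ nv)  (_ ∷ nv′)  (there ins) (there ins′) eq =
  cong₂ _∷_ (List.∷-injectiveˡ eq) (Insertion-injective nv nv′ ins ins′ (List.∷-injectiveʳ eq))

insertions-unique : ∀ k v → NoOne v → Unique (insertions (suc k) v)
insertions-unique k []      _          = [] ∷ []
insertions-unique k (y ∷ v) (1<y ∷ nv) =
  All.map⁺ (All.universal (λ w eq → ℕ.<-irrefl (List.∷-injectiveˡ eq) 1<y) (insertions (suc k) v)) ∷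
  Unique.map⁺ List.∷-injectiveʳ (insertions-unique k v nv)

Insertion⇒↭ : ∀ {k w v} → Insertion k w v → w ↭ replicate k 1 ++ v
Insertion⇒↭         here                    = ↭-refl
Insertion⇒↭ {k} (there {y} {v = v} ins) =
  ↭-trans (prep y (Insertion⇒↭ ins)) (↭-sym (↭.shift y (replicate k 1) v))

length-Insertion : ∀ {k w v} → Insertion k w v → length w ≡ k + length v
length-Insertion {k} {v = v} ins = trans (↭.↭-length (Insertion⇒↭ ins))
  (trans (List.length-++ (replicate k 1)) (cong (_+ length v) (List.length-replicate k)))

count-Insertion : ∀ a {k w v} → Insertion k w v → count a w ≡ (if a ≡ᵇ 1 then k else 0) + count a v
count-Insertion a {k} {v = v} ins = trans (count-↭ a (Insertion⇒↭ ins))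
  (trans (count-++ a (replicate k 1) v) (cong (_+ count a v) (count-replicate a k 1)))

∈-Insertion⁺ : ∀ {k w v x} → Insertion k w v → x ∈ v → x ∈ w
∈-Insertion⁺ {k} ins x∈v = ↭.∈-resp-↭ (↭-sym (Insertion⇒↭ ins)) (∈.∈-++⁺ʳ (replicate k 1) x∈v)

∈-Insertion⁻ : ∀ {k w v x} → 1 < x → Insertion k w v → x ∈ w → x ∈ v
∈-Insertion⁻ {k} 1<x ins x∈w with ∈.∈-++⁻ (replicate k 1) (↭.∈-resp-↭ (Insertion⇒↭ ins) x∈w)
... | inj₁ x∈ones = ⊥-elim (ℕ.<-irrefl (All.lookup (All.replicate⁺ {P = 1 ≡_} k refl) x∈ones) 1<x)
... | inj₂ x∈v    = x∈v

Dominates-++⁻ʳ : ∀ {x} xs {ys} → Dominates x (xs ++ ys) → Dominates x ys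
Dominates-++⁻ʳ []       d       = d
Dominates-++⁻ʳ (_ ∷ xs) (_ , d) = Dominates-++⁻ʳ xs d

Dominates-ones-++ : ∀ {x} k {v} → 1 ≤ x → Dominates x v → Dominates x (replicate k 1 ++ v)
Dominates-ones-++ zero    _   d = d
Dominates-ones-++ (suc k) 1≤x d = (λ _ → 1≤x) , Dominates-ones-++ k 1≤x d

Dominates-∉ : ∀ {x} ys → x ∉ ys → Dominates x ys
Dominates-∉ []       _  = tt
Dominates-∉ (y ∷ ys) x∉ = (λ x∈ → ⊥-elim (x∉ (there x∈))) , Dominates-∉ ys (x∉ ∘ there)

Dominates-insert⁺ : ∀ {k w v x} → 1 < x → Insertion k w v → Dominates x v → Dominates x w
Dominates-insert⁺ {k} 1<x here        d       = Dominates-ones-++ k (ℕ.<⇒≤ 1<x) d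
Dominates-insert⁺     1<x (there ins) (f , d) = f ∘ ∈-Insertion⁻ 1<x ins , Dominates-insert⁺ 1<x ins d

Dominates-insert⁻ : ∀ {k w v x} → Insertion k w v → Dominates x w → Dominates x v
Dominates-insert⁻ {k} here        d       = Dominates-++⁻ʳ (replicate k 1) d
Dominates-insert⁻     (there ins) (f , d) = f ∘ ∈-Insertion⁺ ins , Dominates-insert⁻ ins d

Stirling-ones-++ : ∀ k {v} → 1 ∉ v → Stirling v → Stirling (replicate k 1 ++ v)
Stirling-ones-++ zero        _   s = s
Stirling-ones-++ (suc k) {v} 1∉v s = Dominates-ones-++ k ℕ.≤-refl (Dominates-∉ v 1∉v) , Stirling-ones-++ k 1∉v s

Stirling-insert⁺ : ∀ {k w v} → NoOne v → Insertion k w v → Stirling v → Stirling w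
Stirling-insert⁺ {k} nv         here        s       = Stirling-ones-++ k (ℕ.<-irrefl refl ∘ All.lookup nv) s
Stirling-insert⁺     (1<y ∷ nv) (there ins) (d , s) = Dominates-insert⁺ 1<y ins d , Stirling-insert⁺ nv ins s

Stirling-insert⁻ : ∀ {k w v} → Insertion k w v → Stirling w → Stirling v
Stirling-insert⁻ {zero}  here        s       = s
Stirling-insert⁻ {suc k} here        (_ , s) = Stirling-insert⁻ {k} here s
Stirling-insert⁻         (there ins) (d , s) = Dominates-insert⁻ ins d , Stirling-insert⁻ ins s

count-1≡0⇒NoOne : ∀ xs → All (0 <_) xs → count 1 xs ≡ 0 → NoOne xs
count-1≡0⇒NoOne []                 _         _  = []
count-1≡0⇒NoOne (suc (suc x) ∷ xs) (_ ∷ pos) eq = s≤s (s≤s z≤n) ∷ count-1≡0⇒NoOne xs pos eq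

count-1≡suc⇒∈ : ∀ xs {k} → count 1 xs ≡ suc k → 1 ∈ xs
count-1≡suc⇒∈ (zero        ∷ xs) eq = there (count-1≡suc⇒∈ xs eq)
count-1≡suc⇒∈ (suc zero    ∷ xs) eq = here refl
count-1≡suc⇒∈ (suc (suc _) ∷ xs) eq = there (count-1≡suc⇒∈ xs eq)

ones-contiguous : ∀ k xs → Stirling (1 ∷ xs) → All (0 <_) xs → count 1 xs ≡ k →
  ∃[ v ] (NoOne v × xs ≡ replicate k 1 ++ v)
ones-contiguous zero    xs                 _               pos       eq = xs , count-1≡0⇒NoOne xs pos eq , refl
ones-contiguous (suc k) (suc zero ∷ xs)    (_ , s)         (_ ∷ pos) eq
  with v , nv , refl ← ones-contiguous k xs s pos (ℕ.suc-injective eq) = v , nv , refl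
ones-contiguous (suc k) (suc (suc y) ∷ xs) ((y≤1 , _) , _) (_ ∷ pos) eq
  with s≤s () ← y≤1 (count-1≡suc⇒∈ xs eq)

split-ones : ∀ k w → Stirling w → All (0 <_) w → count 1 w ≡ suc k → ∃[ v ] (NoOne v × Insertion (suc k) w v)
split-ones k (suc zero ∷ xs) s (_ ∷ pos) eq
  with v , nv , refl ← ones-contiguous k xs s pos (ℕ.suc-injective eq) = v , nv , here
split-ones k (suc (suc x) ∷ xs) (_ , s) (_ ∷ pos) eq
  with v , nv , ins ← split-ones k xs s pos eq = suc (suc x) ∷ v , s≤s (s≤s z≤n) ∷ nv , there ins

IsStirlingPerm-insert : ∀ {m n w′ w} → IsStirlingPerm m n w′ → Insertion m w (map suc w′) →
  IsStirlingPerm m (suc n) w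
IsStirlingPerm-insert {m} {n} {w′} {w} p ins = record
  { length≡  = trans (length-Insertion ins)
                 (trans (cong (_+_ m) (trans (List.length-map suc w′) length≡)) (sym (ℕ.*-suc m n)))
  ; letters  = ↭.All-resp-↭ (↭-sym (Insertion⇒↭ ins))
                 (All.++⁺ (All.replicate⁺ m (s≤s z≤n , s≤s z≤n)) (All.map⁺ (All.map raise letters)))
  ; counts   = counts′
  ; stirling = Stirling-insert⁺ (All.map⁺ (All.map (s≤s ∘ proj₁) letters)) ins (Stirling-map-suc⁺ w′ stirling)
  }
  where
  open IsStirlingPerm p
  raise : ∀ {a} → Letter n a → Letter (suc n) (suc a)
  raise (_ , a≤n) = s≤s z≤n , s≤s a≤n
  counts′ : ∀ {i} → i < suc n → count (suc i) w ≡ m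
  counts′ {zero}  _         = trans (count-Insertion 1 ins) (trans (cong (_+_ m)
    (trans (count-map-suc 0 w′) (count-0-positive w′ (All.map proj₁ letters)))) (ℕ.+-identityʳ m))
  counts′ {suc i} (s≤s i<n) =
    trans (count-Insertion (suc (suc i)) ins) (trans (count-map-suc (suc i) w′) (counts i<n))

IsStirlingPerm-split : ∀ {m n w} → IsStirlingPerm (suc m) (suc n) w →
  ∃[ w′ ] (IsStirlingPerm (suc m) n w′ × Insertion (suc m) w (map suc w′))
IsStirlingPerm-split {m} {n} {w} p
  with v , nv , ins ← split-ones m w (IsStirlingPerm.stirling p) (All.map proj₁ (IsStirlingPerm.letters p))
                                     (IsStirlingPerm.counts p (s≤s z≤n))
  with w′ , refl , pos ← NoOne⇒map-suc v nv
  = w′ , record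
  { length≡  = ℕ.+-cancelˡ-≡ (suc m) _ _
                 (trans (sym (trans (length-Insertion ins) (cong (_+_ (suc m)) (List.length-map suc w′))))
                        (trans length≡ (ℕ.*-suc (suc m) n)))
  ; letters  = All.zipWith lower
                 (pos , All.map⁻ (All.++⁻ʳ (replicate (suc m) 1) (↭.All-resp-↭ (Insertion⇒↭ ins) letters)))
  ; counts   = λ {i} i<n → trans (sym (count-map-suc (suc i) w′))
                 (trans (sym (count-Insertion (suc (suc i)) ins)) (counts (s≤s i<n)))
  ; stirling = Stirling-map-suc⁻ w′ (Stirling-insert⁻ ins stirling)
  } , ins
  where
  open IsStirlingPerm p
  lower : ∀ {a} → 0 < a × Letter (suc n) (suc a) → Letter n a
  lower (0<a , _ , s≤s a≤n) = 0<a , a≤n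

stirlingPerms-suc-↭ : ∀ m n →
  stirlingPerms (suc m) (suc n) ↭ concatMap (insertions (suc m) ∘ map suc) (stirlingPerms (suc m) n)
stirlingPerms-suc-↭ m n = ∼bag⇒↭ (unique∧set⇒bag (stirlingPerms-unique (suc m) (suc n)) unique (mk⇔ to from))
  where
  raised-NoOne : ∀ {w′} → w′ ∈ stirlingPerms (suc m) n → NoOne (map suc w′)
  raised-NoOne w′∈ =
    All.map⁺ (All.map (s≤s ∘ proj₁) (IsStirlingPerm.letters (∈-stirlingPerms⁻ (suc m) n w′∈)))
  unique : Unique (concatMap (insertions (suc m) ∘ map suc) (stirlingPerms (suc m) n))
  unique = Unique-concatMap⁺ (insertions (suc m) ∘ map suc) (stirlingPerms-unique (suc m) n)
    (λ {w′} w′∈ → insertions-unique m (map suc w′) (raised-NoOne w′∈))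
    (λ w′∈ w″∈ p q → List.map-injective ℕ.suc-injective
      (Insertion-injective (raised-NoOne w′∈) (raised-NoOne w″∈)
                           (∈-insertions⁻ _ _ p) (∈-insertions⁻ _ _ q) refl))
  to : ∀ {w} → w ∈ stirlingPerms (suc m) (suc n) →
    w ∈ concatMap (insertions (suc m) ∘ map suc) (stirlingPerms (suc m) n)
  to w∈ with w′ , p , ins ← IsStirlingPerm-split (∈-stirlingPerms⁻ (suc m) (suc n) w∈) =
    ∈.∈-concatMap⁺ _ (lose (∈-stirlingPerms⁺ (suc m) n p) (∈-insertions⁺ ins))
  from : ∀ {w} → w ∈ concatMap (insertions (suc m) ∘ map suc) (stirlingPerms (suc m) n) →
    w ∈ stirlingPerms (suc m) (suc n)
  from w∈ with w′ , w′∈ , w∈′ ← find (∈.∈-concatMap⁻ _ {stirlingPerms (suc m) n} w∈) =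
    ∈-stirlingPerms⁺ (suc m) (suc n)
      (IsStirlingPerm-insert (∈-stirlingPerms⁻ (suc m) n w′∈) (∈-insertions⁻ _ _ w∈′))

-- Descents of the insertions

des-1∷ : ∀ u → All (0 <_) u → des (1 ∷ u) ≡ des u
des-1∷ []          _        = refl
des-1∷ (zero ∷ u)  (() ∷ _)
des-1∷ (suc _ ∷ u) _        = refl

des-ones-++ : ∀ k {v} → All (0 <_) v → des (replicate k 1 ++ v) ≡ des v
des-ones-++ zero        pos = refl
des-ones-++ (suc k) {v} pos =
  trans (des-1∷ (replicate k 1 ++ v) (All.++⁺ (All.replicate⁺ k (s≤s z≤n)) pos)) (des-ones-++ k pos)

des-map-suc : ∀ w → des (map suc w) ≡ des w
des-map-suc []          = refl
des-map-suc (x ∷ [])    = refl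
des-map-suc (x ∷ y ∷ w) = cong (_+_ (if y <ᵇ x then 1 else 0)) (des-map-suc (y ∷ w))

des≤length : ∀ w → des w ≤ length w
des≤length []          = z≤n
des≤length (x ∷ [])    = z≤n
des≤length (x ∷ y ∷ w) = ℕ.+-mono-≤ (indicator≤1 (y <ᵇ x)) (des≤length (y ∷ w))
  where
  indicator≤1 : ∀ b → (if b then 1 else 0) ≤ 1
  indicator≤1 true  = ℕ.≤-refl
  indicator≤1 false = z≤n

-- insertionDescents L d lists the descent numbers of the L+1 insertions of a block of ones into a word
-- of length L with d descents and no letter 1; profile d L leaves out the insertion at the front.

profile : ℕ → ℕ → List ℕ
profile d L = replicate d d ++ replicate (L ∸ d) (suc d)

insertionDescents : ℕ → ℕ → List ℕ
insertionDescents L d = d ∷ profile d L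

profile-descent : ∀ d L → suc d ∷ map suc (profile d L) ≡ profile (suc d) (suc L)
profile-descent d L = cong (suc d ∷_) (trans (List.map-++ suc (replicate d d) _)
  (cong₂ _++_ (List.map-replicate suc d d) (List.map-replicate suc (L ∸ d) (suc d))))

profile-ascent : ∀ {d L} → d ≤ L → suc d ∷ profile d L ↭ profile d (suc L)
profile-ascent {d} {L} d≤L = ↭-trans (↭-sym (↭.shift (suc d) (replicate d d) _))
  (↭-reflexive (cong (λ r → replicate d d ++ replicate r (suc d)) (sym (ℕ.+-∸-assoc 1 d≤L))))

map-des-∷ : ∀ y z ws →
  map des (map (y ∷_) (map (z ∷_) ws)) ≡ map (_+_ (if z <ᵇ y then 1 else 0)) (map des (map (z ∷_) ws))
map-des-∷ y z []       = refl
map-des-∷ y z (w ∷ ws) = cong (_ ∷_) (map-des-∷ y z ws)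

descents-after-head : ∀ k y v → NoOne (y ∷ v) →
  map des (map (y ∷_) (insertions (suc k) v)) ↭ profile (des (y ∷ v)) (length (y ∷ v))
descents-after-head k zero          _       (() ∷ _)
descents-after-head k (suc zero)    _       (s≤s () ∷ _)
descents-after-head k (suc (suc _)) []      _        =
  ↭-reflexive (cong (λ d → suc d ∷ []) (des-ones-++ (suc k) []))
descents-after-head k y@(suc (suc _)) (z ∷ v) (_ ∷ nv) = begin
  map des (map (y ∷_) (insertions (suc k) (z ∷ v)))
    ≡⟨ cong₂ _∷_ (cong suc (des-ones-++ (suc k) (All.map (ℕ.<-trans (s≤s z≤n)) nv)))
                 (map-des-∷ y z (insertions (suc k) v)) ⟩
  suc (des (z ∷ v)) ∷ map (_+_ e) (map des (map (z ∷_) (insertions (suc k) v)))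
    ↭⟨ prep _ (↭.map⁺ (_+_ e) (descents-after-head k z v nv)) ⟩
  suc (des (z ∷ v)) ∷ map (_+_ e) (profile (des (z ∷ v)) (length (z ∷ v)))
    ↭⟨ step (z <ᵇ y) ⟩
  profile (e + des (z ∷ v)) (suc (length (z ∷ v))) ∎
  where
  open PermutationReasoning
  e = if z <ᵇ y then 1 else 0
  step : ∀ b → suc (des (z ∷ v)) ∷ map (_+_ (if b then 1 else 0)) (profile (des (z ∷ v)) (length (z ∷ v)))
             ↭ profile ((if b then 1 else 0) + des (z ∷ v)) (suc (length (z ∷ v)))
  step true  = ↭-reflexive (profile-descent (des (z ∷ v)) (length (z ∷ v)))
  step false = ↭-trans (prep _ (↭-reflexive (List.map-id _))) (profile-ascent (des≤length (z ∷ v)))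

descents-insertions : ∀ k v → NoOne v → map des (insertions (suc k) v) ↭ insertionDescents (length v) (des v)
descents-insertions k []      _  = ↭-reflexive (cong (_∷ []) (des-ones-++ (suc k) []))
descents-insertions k (y ∷ v) nv = ↭-trans
  (↭-reflexive (cong (_∷ map des (map (y ∷_) (insertions (suc k) v)))
    (des-ones-++ (suc k) (All.map (ℕ.<-trans (s≤s z≤n)) nv))))
  (prep _ (descents-after-head k y v nv))

descents : ℕ → ℕ → List ℕ
descents m n = map des (stirlingPerms m n)

concatMap-↭ : ∀ {A B : Set} {f g : A → List B} xs →
  (∀ {x} → x ∈ xs → f x ↭ g x) → concatMap f xs ↭ concatMap g xs
concatMap-↭ []       _   = ↭-refl
concatMap-↭ (x ∷ xs) f↭g = ↭.++⁺ (f↭g (here refl)) (concatMap-↭ xs (f↭g ∘ there))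

descents-suc-↭ : ∀ m n →
  descents (suc m) (suc n) ↭ concatMap (insertionDescents (suc m * n)) (descents (suc m) n)
descents-suc-↭ m n = begin
  map des (stirlingPerms (suc m) (suc n))
    ↭⟨ ↭.map⁺ des (stirlingPerms-suc-↭ m n) ⟩
  map des (concatMap (insertions (suc m) ∘ map suc) (stirlingPerms (suc m) n))
    ≡⟨ List.map-concatMap des (insertions (suc m) ∘ map suc) (stirlingPerms (suc m) n) ⟩
  concatMap (map des ∘ insertions (suc m) ∘ map suc) (stirlingPerms (suc m) n)
    ↭⟨ concatMap-↭ (stirlingPerms (suc m) n) raised-insertions ⟩
  concatMap (insertionDescents (suc m * n) ∘ des) (stirlingPerms (suc m) n)
    ≡⟨ List.concatMap-map (insertionDescents (suc m * n)) des (stirlingPerms (suc m) n) ⟨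
  concatMap (insertionDescents (suc m * n)) (map des (stirlingPerms (suc m) n)) ∎
  where
  open PermutationReasoning
  raised-insertions : ∀ {w′} → w′ ∈ stirlingPerms (suc m) n →
    map des (insertions (suc m) (map suc w′)) ↭ insertionDescents (suc m * n) (des w′)
  raised-insertions {w′} w′∈ = ↭-trans
    (descents-insertions m (map suc w′) (All.map⁺ (All.map (s≤s ∘ proj₁) letters)))
    (↭-reflexive (cong₂ insertionDescents (trans (List.length-map suc w′) length≡) (des-map-suc w′)))
    where open IsStirlingPerm (∈-stirlingPerms⁻ (suc m) n w′∈)

≡ᵇ-comm : ∀ m n → (m ≡ᵇ n) ≡ (n ≡ᵇ m)
≡ᵇ-comm zero    zero    = refl
≡ᵇ-comm zero    (suc n) = refl
≡ᵇ-comm (suc m) zero    = refl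
≡ᵇ-comm (suc m) (suc n) = ≡ᵇ-comm m n

≡ᵇ-true⇒≡ : ∀ {m n} → (m ≡ᵇ n) ≡ true → m ≡ n
≡ᵇ-true⇒≡ {m} {n} eq = ℕ.≡ᵇ⇒≡ m n (subst IsTrue (sym eq) tt)

T≡count-descents : ∀ m n k → T m n k ≡ count k (descents m n)
T≡count-descents m n k = go (stirlingPerms m n)
  where
  go : ∀ ws → length (filterᵇ (λ w → des w ≡ᵇ k) ws) ≡ count k (map des ws)
  go []       = refl
  go (w ∷ ws) rewrite ≡ᵇ-comm k (des w) with des w ≡ᵇ k
  ... | true  = cong suc (go ws)
  ... | false = go ws

count-insertionDescents-zero : ∀ N ds → count 0 (concatMap (insertionDescents N) ds) ≡ count 0 ds
count-insertionDescents-zero N []       = refl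
count-insertionDescents-zero N (d ∷ ds) = begin
  count 0 (insertionDescents N d ++ concatMap (insertionDescents N) ds)
    ≡⟨ count-++ 0 (insertionDescents N d) _ ⟩
  count 0 (insertionDescents N d) + count 0 (concatMap (insertionDescents N) ds)
    ≡⟨ cong₂ _+_ (single d) (count-insertionDescents-zero N ds) ⟩
  (if 0 ≡ᵇ d then 1 else 0) + count 0 ds ∎
  where
  open ≡-Reasoning
  single : ∀ d → count 0 (insertionDescents N d) ≡ (if 0 ≡ᵇ d then 1 else 0)
  single d rewrite count-++ 0 (replicate (suc d) d) (replicate (N ∸ d) (suc d))
                 | count-replicate 0 (suc d) d | count-replicate 0 (N ∸ d) (suc d) with d
  ... | zero  = refl
  ... | suc _ = refl

count-insertionDescents-suc : ∀ N j ds →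
  count (suc j) (concatMap (insertionDescents N) ds) ≡ count (suc j) ds * (2 + j) + count j ds * (N ∸ j)
count-insertionDescents-suc N j []       = refl
count-insertionDescents-suc N j (d ∷ ds) = begin
  count (suc j) (insertionDescents N d ++ concatMap (insertionDescents N) ds)
    ≡⟨ count-++ (suc j) (insertionDescents N d) _ ⟩
  count (suc j) (insertionDescents N d) + count (suc j) (concatMap (insertionDescents N) ds)
    ≡⟨ cong₂ _+_ single (count-insertionDescents-suc N j ds) ⟩
  (ι (suc j) * (2 + j) + ι j * (N ∸ j)) + (count (suc j) ds * (2 + j) + count j ds * (N ∸ j))
    ≡⟨ interchange (ι (suc j) * (2 + j)) (ι j * (N ∸ j)) (count (suc j) ds * (2 + j)) (count j ds * (N ∸ j)) ⟩
  (ι (suc j) * (2 + j) + count (suc j) ds * (2 + j)) + (ι j * (N ∸ j) + count j ds * (N ∸ j))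
    ≡⟨ cong₂ _+_ (ℕ.*-distribʳ-+ (2 + j) (ι (suc j)) _) (ℕ.*-distribʳ-+ (N ∸ j) (ι j) _) ⟨
  (ι (suc j) + count (suc j) ds) * (2 + j) + (ι j + count j ds) * (N ∸ j) ∎
  where
  open ≡-Reasoning
  ι : ℕ → ℕ
  ι a = if a ≡ᵇ d then 1 else 0
  single : count (suc j) (insertionDescents N d) ≡ ι (suc j) * (2 + j) + ι j * (N ∸ j)
  single rewrite count-++ (suc j) (replicate (suc d) d) (replicate (N ∸ d) (suc d))
               | count-replicate (suc j) (suc d) d | count-replicate (suc j) (N ∸ d) (suc d)
    with suc j ≡ᵇ d in e₁ | j ≡ᵇ d in e₂
  ... | true  | true  = ⊥-elim (ℕ.1+n≢n (trans (≡ᵇ-true⇒≡ {suc j} e₁) (sym (≡ᵇ-true⇒≡ {j} e₂))))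
  ... | true  | false = trans (ℕ.+-identityʳ (suc d))
    (trans (cong suc (sym (≡ᵇ-true⇒≡ {suc j} e₁))) (sym (trans (ℕ.+-identityʳ _) (ℕ.*-identityˡ (2 + j)))))
  ... | false | true  = trans (cong (N ∸_) (sym (≡ᵇ-true⇒≡ {j} e₂))) (sym (ℕ.*-identityˡ (N ∸ j)))
  ... | false | false = refl

T-suc-zero : ∀ m n → T (suc m) (suc n) 0 ≡ T (suc m) n 0
T-suc-zero m n = begin
  T (suc m) (suc n) 0
    ≡⟨ T≡count-descents (suc m) (suc n) 0 ⟩
  count 0 (descents (suc m) (suc n))
    ≡⟨ count-↭ 0 (descents-suc-↭ m n) ⟩
  count 0 (concatMap (insertionDescents (suc m * n)) (descents (suc m) n))
    ≡⟨ count-insertionDescents-zero (suc m * n) (descents (suc m) n) ⟩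
  count 0 (descents (suc m) n)
    ≡⟨ T≡count-descents (suc m) n 0 ⟨
  T (suc m) n 0 ∎
  where open ≡-Reasoning

T-suc-suc : ∀ m n j →
  T (suc m) (suc n) (suc j) ≡ T (suc m) n (suc j) * (2 + j) + T (suc m) n j * (suc m * n ∸ j)
T-suc-suc m n j = begin
  T (suc m) (suc n) (suc j)
    ≡⟨ T≡count-descents (suc m) (suc n) (suc j) ⟩
  count (suc j) (descents (suc m) (suc n))
    ≡⟨ count-↭ (suc j) (descents-suc-↭ m n) ⟩
  count (suc j) (concatMap (insertionDescents (suc m * n)) (descents (suc m) n))
    ≡⟨ count-insertionDescents-suc (suc m * n) j (descents (suc m) n) ⟩
  count (suc j) (descents (suc m) n) * (2 + j) + count j (descents (suc m) n) * (suc m * n ∸ j)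
    ≡⟨ cong₂ (λ a b → a * (2 + j) + b * (suc m * n ∸ j))
             (T≡count-descents (suc m) n (suc j)) (T≡count-descents (suc m) n j) ⟨
  T (suc m) n (suc j) * (2 + j) + T (suc m) n j * (suc m * n ∸ j) ∎
  where open ≡-Reasoning

count-All-< : ∀ {j} ds → All (_< j) ds → count j ds ≡ 0
count-All-< []           []           = refl
count-All-< {j} (d ∷ ds) (d<j ∷ ds<j) with j ≡ᵇ d in e
... | true  = ⊥-elim (ℕ.<-irrefl (sym (≡ᵇ-true⇒≡ {j} e)) d<j)
... | false = count-All-< ds ds<j

mn<k⇒T≡0 : ∀ m n k → m * n < k → T m n k ≡ 0
mn<k⇒T≡0 m n k mn<k = trans (T≡count-descents m n k) (count-All-< (descents m n)
  (All.map⁺ (All.tabulate λ {w} w∈ → ℕ.≤-<-trans (des≤length w)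
     (ℕ.≤-<-trans (ℕ.≤-reflexive (IsStirlingPerm.length≡ (∈-stirlingPerms⁻ m n w∈))) mn<k))))

+-T-eulerianStep : ∀ m n → (+_ ∘ T (suc m) (suc n)) ≗ eulerianStep (suc m * n) (+_ ∘ T (suc m) n)
+-T-eulerianStep m n zero    = trans (cong +_ (T-suc-zero m n))
  (sym (trans (ℤ.+-identityʳ _) (ℤ.*-identityˡ (+ T (suc m) n 0))))
+-T-eulerianStep m n (suc j) = begin
  + T (suc m) (suc n) (suc j)
    ≡⟨ cong +_ (T-suc-suc m n j) ⟩
  + (a * (2 + j) + b * (N ∸ j))
    ≡⟨ ℤ.pos-+ (a * (2 + j)) (b * (N ∸ j)) ⟩
  + (a * (2 + j)) ℤ.+ + (b * (N ∸ j))
    ≡⟨ cong₂ ℤ._+_ (trans (ℤ.pos-* a (2 + j)) (ℤ.*-comm (+ a) (+ (2 + j)))) truncated ⟩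
  + (2 + j) ℤ.* + a ℤ.+ (+ N ℤ.- + j) ℤ.* + b ∎
  where
  open ≡-Reasoning
  N = suc m * n
  a = T (suc m) n (suc j)
  b = T (suc m) n j
  -- N ∸ j is truncated, but for j > N the factor b vanishes.
  truncated : + (b * (N ∸ j)) ≡ (+ N ℤ.- + j) ℤ.* + b
  truncated with j ≤? N
  ... | yes j≤N = trans (ℤ.pos-* b (N ∸ j)) (trans (ℤ.*-comm (+ b) _)
    (cong (ℤ._* + b) (sym (trans (ℤ.m-n≡m⊖n N j) (ℤ.⊖-≥ j≤N)))))
  ... | no  j≰N rewrite mn<k⇒T≡0 (suc m) n j (ℕ.≰⇒> j≰N) = sym (ℤ.*-zeroʳ (+ N ℤ.- + j))

+-T-2-zero : (+_ ∘ T 2 0) ≗ δ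
+-T-2-zero zero    = refl
+-T-2-zero (suc k) = refl

f-as-⋆ : ∀ m n j → + f m n (suc j) ≡ ((+_ ∘ T m n) ⋆ [1-t]^-[1+] (m * n)) j
f-as-⋆ m n j = trans (sum-applyUpTo (suc j) _ (λ i → i))
  (∑<-cong (suc j) (λ {i} _ → ℤ.pos-* (T m n i) ((j ∸ i + m * n) C (m * n))))

altSum-as-⋆ : ∀ N g k → altSum N g k ≡ ((+_ ∘ g ∘ suc) ⋆ [1-t]^ N) k
altSum-as-⋆ N g k = trans (foldr-applyUpTo (suc k) _ (λ i → i)) (∑<-cong (suc k) (λ {i} _ → term i))
  where
  term : ∀ i →
    (-1ℤ ℤ.^ (k + 1 ∸ suc i)) ℤ.* + ((N C (k + 1 ∸ suc i)) * g (suc i)) ≡ + g (suc i) ℤ.* [1-t]^ N (k ∸ i)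
  term i rewrite ℕ.+-comm k 1 = trans (cong ((-1ℤ ℤ.^ (k ∸ i)) ℤ.*_) (ℤ.pos-* (N C (k ∸ i)) (g (suc i))))
    (solve 3 (λ p c x → p :* (c :* x) := x :* (p :* c)) refl (-1ℤ ℤ.^ (k ∸ i)) (+ (N C (k ∸ i))) (+ g (suc i)))

altSum-cong : ∀ N {g h : ℕ → ℕ} k → (∀ i → g (suc i) ≡ h (suc i)) → altSum N g k ≡ altSum N h k
altSum-cong N {g} {h} k eq =
  trans (altSum-as-⋆ N g k) (trans (⋆-congˡ ([1-t]^ N) (cong +_ ∘ eq) k) (sym (altSum-as-⋆ N h k)))

eulerian-inversion : ∀ m n k → + T m n k ≡ altSum (m * n + 1) (f m n) k
eulerian-inversion m n k = sym (begin
  altSum (m * n + 1) (f m n) k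
    ≡⟨ altSum-as-⋆ (m * n + 1) (f m n) k ⟩
  ((+_ ∘ f m n ∘ suc) ⋆ [1-t]^ (m * n + 1)) k
    ≡⟨ ⋆-cong (f-as-⋆ m n) (λ r → cong (λ M → [1-t]^ M r) (ℕ.+-comm (m * n) 1)) k ⟩
  (((+_ ∘ T m n) ⋆ [1-t]^-[1+] (m * n)) ⋆ [1-t]^ (suc (m * n))) k
    ≡⟨ [1-t]^-inverse (m * n) (+_ ∘ T m n) k ⟩
  + T m n k ∎)
  where open ≡-Reasoning

f-2≡S₂ : ∀ n i → f 2 n (suc i) ≡ S₂ (n + suc i) (suc i)
f-2≡S₂ n i = ℤ.+-injective (trans (f-as-⋆ 2 n i)
  (⋆-[1-t]^-[1+]≡S₂ (λ n → +_ ∘ T 2 n) +-T-2-zero (+-T-eulerianStep 1) n i))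

theorem3p5 : ((m n k : ℕ) → m ≥ 1 → n ≥ 1 →
    + T m n k ≡ altSum (m * n + 1) (f m n) k)
    × ((n k : ℕ) → n ≥ 1 →
    (+ T 2 n k ≡ altSum (2 * n + 1) (f 2 n) k)
    × (altSum (2 * n + 1) (f 2 n) k ≡ altSum (2 * n + 1) (λ ℓ → S₂ (n + ℓ) ℓ) k))
theorem3p5 =
  (λ m n k _ _ → eulerian-inversion m n k) ,
  (λ n k _ → eulerian-inversion 2 n k , altSum-cong (2 * n + 1) {f 2 n} {λ ℓ → S₂ (n + ℓ) ℓ} k (f-2≡S₂ n))
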